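{- In $\mathrm{PL}(=\!(\cdot))$, the following are equivalent: (i) $\phi$ and $\psi$ are ground-complementary; (ii) there is a formula $\theta$ such that $\phi\equiv \theta$ and $\psi \equiv \neg \theta$ (and $\mathsf{P}(\theta)= \mathsf{P}(\phi)\cup \mathsf{P}(\psi)$).
   Context: Propositional dependence logic $\mathrm{PL}(=\!(\cdot))$: $\phi ::= p \mid \bot \mid \neg\phi \mid \phi\wedge\phi \mid \phi\vee\phi \mid {=}\!(p_1,\ldots,p_n,q)$, on propositional teams with support $\models$ / anti-support $\models^-$: $p$ supported iff all $w\in s$ make $p$ true, anti-supported iff none do; $s\models\bot$ iff $s=\emptyset$, $\bot$ always anti-supported; $s\models{=}\!(p_1,\ldots,p_n,q)$ iff any $v,w\in s$ agreeing on all $p_i$ agree on $q$, anti-supported iff $s=\emptyset$; $\neg$ swaps support and anti-support; $\wedge$ supported iff both are, anti-supported iff $s=t\cup u$ with $t\models^-\phi,u\models^-\psi$; $\vee$ supported iff $s=t\cup u$ with $t\models\phi,u\models\psi$, anti-supported iff both are. $\top:=\neg\bot$; ground team $|\phi|_\mathsf{X}$: valuations over $\mathsf{X}$ belonging to some team over $\mathsf{X}$ supporting $\phi$. $\phi,\psi$ ground-complementary: $|\phi|_\mathsf{X}=|\top|_\mathsf{X}\setminus|\psi|_\mathsf{X}$ and $|\psi|_\mathsf{X}=|\top|_\mathsf{X}\setminus|\phi|_\mathsf{X}$ for all $\mathsf{X}\supseteq\mathsf{P}(\phi)\cup\mathsf{P}(\psi)$. -}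

module Defs where

open import Level using (Level; 0ℓ; Lift) renaming (suc to lsuc)
open import Data.Nat using (ℕ)
open import Data.Bool using (Bool; true; false)
open import Data.List using (List; []; _∷_; _++_)
open import Data.List.Membership.Propositional using (_∈_)
open import Data.List.Relation.Unary.All using (All)
open import Data.Product using (Σ; _×_; _,_)
open import Data.Sum using (_⊎_)
open import Data.Unit.Polymorphic using (⊤)
open import Relation.Nullary using (¬_)
open import Relation.Binary.PropositionalEquality using (_≡_)
open import Function.Bundles using (_⇔_)

Var : Set
Var = ℕ

data Form : Set where
  atom : Var → Form
  bot  : Form
  neg  : Form → Form
  _∧'_ : Form → Form → Form
  _∨'_ : Form → Form → Form
  dep  : List Var → Var → Form

top : Form
top = neg bot

vars : Form → List Var
vars (atom p)  = p ∷ []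
vars bot       = []
vars (neg φ)   = vars φ
vars (φ ∧' ψ)  = vars φ ++ vars ψ
vars (φ ∨' ψ)  = vars φ ++ vars ψ
vars (dep ps q) = ps ++ (q ∷ [])

-- Valuations: total functions; a valuation "over X" is one that is false
-- outside X (canonical representation of a valuation with domain X).
Val : Set
Val = Var → Bool

Team : Set₁
Team = Val → Set

ValOver : List Var → Val → Set
ValOver X v = ∀ p → ¬ (p ∈ X) → v p ≡ false

TeamOver : List Var → Team → Set
TeamOver X s = ∀ v → s v → ValOver X v

_≐_∪_ : Team → Team → Team → Set
s ≐ t ∪ u = ∀ v → s v ⇔ (t v ⊎ u v)

mutual
  _⊨_ : Team → Form → Set₁
  s ⊨ atom p   = Lift (lsuc 0ℓ) (∀ v → s v → v p ≡ true)
  s ⊨ bot      = Lift (lsuc 0ℓ) (∀ v → ¬ s v)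
  s ⊨ neg φ    = s ⊨⁻ φ
  s ⊨ (φ ∧' ψ) = s ⊨ φ × s ⊨ ψ
  s ⊨ (φ ∨' ψ) = Σ Team λ t → Σ Team λ u → Lift (lsuc 0ℓ) (s ≐ t ∪ u) × t ⊨ φ × u ⊨ ψ
  s ⊨ dep ps q = Lift (lsuc 0ℓ) (∀ v w → s v → s w → All (λ p → v p ≡ w p) ps → v q ≡ w q)

  _⊨⁻_ : Team → Form → Set₁
  s ⊨⁻ atom p   = Lift (lsuc 0ℓ) (∀ v → s v → v p ≡ false)
  s ⊨⁻ bot      = ⊤
  s ⊨⁻ neg φ    = s ⊨ φ
  s ⊨⁻ (φ ∧' ψ) = Σ Team λ t → Σ Team λ u → Lift (lsuc 0ℓ) (s ≐ t ∪ u) × t ⊨⁻ φ × u ⊨⁻ ψ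
  s ⊨⁻ (φ ∨' ψ) = s ⊨⁻ φ × s ⊨⁻ ψ
  s ⊨⁻ dep ps q = Lift (lsuc 0ℓ) (∀ v → ¬ s v)

_⊇vars_,_ : List Var → Form → Form → Set
X ⊇vars φ , ψ = ∀ p → (p ∈ vars φ ⊎ p ∈ vars ψ) → p ∈ X

∣_∣ : Form → List Var → Val → Set₁
∣ φ ∣ X v = Σ Team λ s → Lift (lsuc 0ℓ) (TeamOver X s) × s ⊨ φ × Lift (lsuc 0ℓ) (s v)

ComplIn : List Var → Form → Form → Set₁
ComplIn X φ ψ = ∀ v → ∣ φ ∣ X v ⇔ (∣ top ∣ X v × ¬ ∣ ψ ∣ X v)

GroundComplementary : Form → Form → Set₁
GroundComplementary φ ψ =
  ∀ (X : List Var) → X ⊇vars φ , ψ → ComplIn X φ ψ × ComplIn X ψ φ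

_≡F_ : Form → Form → Set₁
φ ≡F ψ = ∀ (X : List Var) → X ⊇vars φ , ψ →
         ∀ (s : Team) → TeamOver X s → s ⊨ φ ⇔ s ⊨ ψ

SameVars : Form → Form → Form → Set
SameVars θ φ ψ = ∀ p → p ∈ vars θ ⇔ (p ∈ vars φ ⊎ p ∈ vars ψ)

{-# OPTIONS --safe #-}

-- Reading dependence atoms as true gives every formula a classical truth value ⟦ φ ⟧ v.
-- Supporting teams consist of valuations where φ is true, anti-supporting ones of
-- valuations where it is false, and {v} supports φ exactly when ⟦ φ ⟧ v is true; so
-- |φ|_X is the set of valuations over X making φ classically true, and ground
-- complementarity says that ⟦ φ ⟧ and ⟦ ψ ⟧ disagree on every valuation over X.  As
-- equivalent formulas agree on singletons, φ ≡ θ and ψ ≡ ¬θ force this.  Conversely,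
-- let c be φ with its dependence atoms replaced by ⊤ (a flat formula classically
-- equivalent to φ) and put θ = (φ ∨ ¬c) ∧ (¬ψ ∨ c).  A team supporting the right
-- conjunct makes φ classically true throughout, so the ¬c-part of the left conjunct is
-- empty and the team supports φ by downward closure.  Dually, the part of a team
-- anti-supporting the left conjunct is empty, so anti-supporting θ amounts to
-- supporting ψ.
module Submission where

open import Defs
open import Level using (lift)
open import Data.Bool using (Bool; true; false; not; _∧_; _∨_)
open import Data.Bool.Properties
  using (not-injective; not-¬; ¬-not; ∧-conicalˡ; ∧-conicalʳ; ∧-zeroʳ; ∨-conicalˡ; ∨-conicalʳ; ∨-zeroʳ)
  renaming (_≟_ to _≟ᵇ_)
open import Data.Empty using (⊥-elim)
open import Data.Unit.Polymorphic using (tt)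
open import Data.List using (_++_)
open import Data.List.Membership.Propositional using (_∈_)
open import Data.List.Membership.Propositional.Properties using (∈-++⁺ˡ; ∈-++⁺ʳ; ∈-++⁻)
open import Data.List.Relation.Binary.Subset.Propositional using () renaming (_⊆_ to _⊆ᵛ_)
open import Data.List.Relation.Binary.Subset.Propositional.Properties using (++⁺)
open import Data.Product using (Σ; _×_; _,_; proj₁; proj₂)
open import Data.Sum using (_⊎_; inj₁; inj₂; [_,_]′)
open import Function using (_∘_; id)
open import Function.Bundles using (_⇔_; mk⇔; Equivalence)
open import Relation.Nullary using (¬_; yes; no; contradiction)
open import Relation.Unary using (_⊆_; _⊥_; ∅; ｛_｝; _∩_; Empty)
open import Relation.Binary.PropositionalEquality using (_≡_; _≢_; refl; sym; trans; cong; cong₂; ≢-sym)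

open Equivalence using (to; from)

⟦_⟧ : Form → Val → Bool
⟦ atom p ⟧   v = v p
⟦ bot ⟧      v = false
⟦ neg φ ⟧    v = not (⟦ φ ⟧ v)
⟦ φ ∧' ψ ⟧   v = ⟦ φ ⟧ v ∧ ⟦ ψ ⟧ v
⟦ φ ∨' ψ ⟧   v = ⟦ φ ⟧ v ∨ ⟦ ψ ⟧ v
⟦ dep _ _ ⟧  v = true

⟦_⟧⁻¹ : Form → Bool → Team
⟦ φ ⟧⁻¹ b v = ⟦ φ ⟧ v ≡ b

⟦⟧⁻¹-disjoint : ∀ φ b → ⟦ φ ⟧⁻¹ b ⊥ ⟦ φ ⟧⁻¹ (not b)
⟦⟧⁻¹-disjoint φ b (φv≡b , φv≡¬b) = not-¬ refl (trans (sym φv≡b) φv≡¬b)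

classical : Form → Form
classical (atom p)   = atom p
classical bot        = bot
classical (neg φ)    = neg (classical φ)
classical (φ ∧' ψ)   = classical φ ∧' classical ψ
classical (φ ∨' ψ)   = classical φ ∨' classical ψ
classical (dep _ _)  = top

⟦classical⟧ : ∀ φ v → ⟦ classical φ ⟧ v ≡ ⟦ φ ⟧ v
⟦classical⟧ (atom p)   v = refl
⟦classical⟧ bot        v = refl
⟦classical⟧ (neg φ)    v = cong not (⟦classical⟧ φ v)
⟦classical⟧ (φ ∧' ψ)   v = cong₂ _∧_ (⟦classical⟧ φ v) (⟦classical⟧ ψ v)
⟦classical⟧ (φ ∨' ψ)   v = cong₂ _∨_ (⟦classical⟧ φ v) (⟦classical⟧ ψ v)
⟦classical⟧ (dep _ _)  v = refl

vars-classical : ∀ φ → vars (classical φ) ⊆ᵛ vars φ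
vars-classical (atom p)   p∈ = p∈
vars-classical bot        ()
vars-classical (neg φ)    = vars-classical φ
vars-classical (φ ∧' ψ)   = ++⁺ (vars-classical φ) (vars-classical ψ)
vars-classical (φ ∨' ψ)   = ++⁺ (vars-classical φ) (vars-classical ψ)
vars-classical (dep _ _)  ()

≐-∪-identityˡ : ∀ {s} → s ≐ ∅ ∪ s
≐-∪-identityˡ v = mk⇔ inj₂ [ (λ ()) , id ]′

≐-∪-identityʳ : ∀ {s} → s ≐ s ∪ ∅
≐-∪-identityʳ v = mk⇔ inj₁ [ id , (λ ()) ]′

≐-∪-restrict : ∀ {s t u s′} → s′ ⊆ s → s ≐ t ∪ u → s′ ≐ (s′ ∩ t) ∪ (s′ ∩ u)
≐-∪-restrict {s} {t} {u} {s′} s′⊆s s=t∪u v = mk⇔ classify [ proj₁ , proj₁ ]′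
  where
  classify : s′ v → (s′ ∩ t) v ⊎ (s′ ∩ u) v
  classify s′v with to (s=t∪u v) (s′⊆s s′v)
  ... | inj₁ tv = inj₁ (s′v , tv)
  ... | inj₂ uv = inj₂ (s′v , uv)

≐-∪-partition : ∀ φ b {s} → s ≐ (s ∩ ⟦ φ ⟧⁻¹ b) ∪ (s ∩ ⟦ φ ⟧⁻¹ (not b))
≐-∪-partition φ b {s} v = mk⇔ classify [ proj₁ , proj₁ ]′
  where
  classify : s v → (s ∩ ⟦ φ ⟧⁻¹ b) v ⊎ (s ∩ ⟦ φ ⟧⁻¹ (not b)) v
  classify sv with ⟦ φ ⟧ v ≟ᵇ b
  ... | yes φv≡b = inj₁ (sv , φv≡b)
  ... | no  φv≢b = inj₂ (sv , ¬-not φv≢b)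

≐-∪-⊆ˡ : ∀ {s t u} → s ≐ t ∪ u → s ⊥ u → s ⊆ t
≐-∪-⊆ˡ s=t∪u s⊥u {v} sv with to (s=t∪u v) sv
... | inj₁ tv = tv
... | inj₂ uv = ⊥-elim (s⊥u (sv , uv))

≐-∪-⊆ʳ : ∀ {s t u} → s ≐ t ∪ u → s ⊥ t → s ⊆ u
≐-∪-⊆ʳ s=t∪u s⊥t {v} sv with to (s=t∪u v) sv
... | inj₁ tv = ⊥-elim (s⊥t (sv , tv))
... | inj₂ uv = uv

mutual
  ⊨-downClosed : ∀ φ {s t} → t ⊆ s → s ⊨ φ → t ⊨ φ
  ⊨-downClosed (atom p)   t⊆s (lift s⊨p)  = lift λ v tv → s⊨p v (t⊆s tv)
  ⊨-downClosed bot        t⊆s (lift s≡∅)  = lift λ v tv → s≡∅ v (t⊆s tv)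
  ⊨-downClosed (neg φ)    t⊆s s⊨¬φ        = ⊨⁻-downClosed φ t⊆s s⊨¬φ
  ⊨-downClosed (φ ∧' ψ)   t⊆s (s⊨φ , s⊨ψ) = ⊨-downClosed φ t⊆s s⊨φ , ⊨-downClosed ψ t⊆s s⊨ψ
  ⊨-downClosed (φ ∨' ψ) {t = t} t⊆s (s₁ , s₂ , lift s=s₁∪s₂ , s₁⊨φ , s₂⊨ψ) =
    t ∩ s₁ , t ∩ s₂ , lift (≐-∪-restrict t⊆s s=s₁∪s₂) ,
    ⊨-downClosed φ proj₂ s₁⊨φ , ⊨-downClosed ψ proj₂ s₂⊨ψ
  ⊨-downClosed (dep ps q) t⊆s (lift s⊨dep) = lift λ v w tv tw → s⊨dep v w (t⊆s tv) (t⊆s tw)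

  ⊨⁻-downClosed : ∀ φ {s t} → t ⊆ s → s ⊨⁻ φ → t ⊨⁻ φ
  ⊨⁻-downClosed (atom p)   t⊆s (lift s⊨¬p) = lift λ v tv → s⊨¬p v (t⊆s tv)
  ⊨⁻-downClosed bot        t⊆s _           = tt
  ⊨⁻-downClosed (neg φ)    t⊆s s⊨φ         = ⊨-downClosed φ t⊆s s⊨φ
  ⊨⁻-downClosed (φ ∧' ψ) {t = t} t⊆s (s₁ , s₂ , lift s=s₁∪s₂ , s₁⊨¬φ , s₂⊨¬ψ) =
    t ∩ s₁ , t ∩ s₂ , lift (≐-∪-restrict t⊆s s=s₁∪s₂) ,
    ⊨⁻-downClosed φ proj₂ s₁⊨¬φ , ⊨⁻-downClosed ψ proj₂ s₂⊨¬ψ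
  ⊨⁻-downClosed (φ ∨' ψ)   t⊆s (s⊨¬φ , s⊨¬ψ) = ⊨⁻-downClosed φ t⊆s s⊨¬φ , ⊨⁻-downClosed ψ t⊆s s⊨¬ψ
  ⊨⁻-downClosed (dep ps q) t⊆s (lift s≡∅)   = lift λ v tv → s≡∅ v (t⊆s tv)

mutual
  ⊨-empty : ∀ φ {s} → Empty s → s ⊨ φ
  ⊨-empty (atom p)   s≡∅ = lift λ v sv → ⊥-elim (s≡∅ v sv)
  ⊨-empty bot        s≡∅ = lift s≡∅
  ⊨-empty (neg φ)    s≡∅ = ⊨⁻-empty φ s≡∅
  ⊨-empty (φ ∧' ψ)   s≡∅ = ⊨-empty φ s≡∅ , ⊨-empty ψ s≡∅
  ⊨-empty (φ ∨' ψ)   s≡∅ = _ , ∅ , lift ≐-∪-identityʳ , ⊨-empty φ s≡∅ , ⊨-empty ψ λ _ ()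
  ⊨-empty (dep ps q) s≡∅ = lift λ v w sv _ _ → ⊥-elim (s≡∅ v sv)

  ⊨⁻-empty : ∀ φ {s} → Empty s → s ⊨⁻ φ
  ⊨⁻-empty (atom p)   s≡∅ = lift λ v sv → ⊥-elim (s≡∅ v sv)
  ⊨⁻-empty bot        s≡∅ = tt
  ⊨⁻-empty (neg φ)    s≡∅ = ⊨-empty φ s≡∅
  ⊨⁻-empty (φ ∧' ψ)   s≡∅ = _ , ∅ , lift ≐-∪-identityʳ , ⊨⁻-empty φ s≡∅ , ⊨⁻-empty ψ λ _ ()
  ⊨⁻-empty (φ ∨' ψ)   s≡∅ = ⊨⁻-empty φ s≡∅ , ⊨⁻-empty ψ s≡∅
  ⊨⁻-empty (dep ps q) s≡∅ = lift s≡∅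

mutual
  ⊨-sound : ∀ φ {s} → s ⊨ φ → s ⊆ ⟦ φ ⟧⁻¹ true
  ⊨-sound (atom p)   (lift s⊨p)  sv = s⊨p _ sv
  ⊨-sound bot        (lift s≡∅)  sv = ⊥-elim (s≡∅ _ sv)
  ⊨-sound (neg φ)    s⊨¬φ        sv = cong not (⊨⁻-sound φ s⊨¬φ sv)
  ⊨-sound (φ ∧' ψ)   (s⊨φ , s⊨ψ) sv = cong₂ _∧_ (⊨-sound φ s⊨φ sv) (⊨-sound ψ s⊨ψ sv)
  ⊨-sound (φ ∨' ψ)   (_ , _ , lift s=s₁∪s₂ , s₁⊨φ , s₂⊨ψ) {v} sv with to (s=s₁∪s₂ v) sv
  ... | inj₁ s₁v = cong (_∨ ⟦ ψ ⟧ v) (⊨-sound φ s₁⊨φ s₁v)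
  ... | inj₂ s₂v = trans (cong (⟦ φ ⟧ v ∨_) (⊨-sound ψ s₂⊨ψ s₂v)) (∨-zeroʳ _)
  ⊨-sound (dep ps q) _           sv = refl

  ⊨⁻-sound : ∀ φ {s} → s ⊨⁻ φ → s ⊆ ⟦ φ ⟧⁻¹ false
  ⊨⁻-sound (atom p)   (lift s⊨¬p)   sv = s⊨¬p _ sv
  ⊨⁻-sound bot        _             sv = refl
  ⊨⁻-sound (neg φ)    s⊨φ           sv = cong not (⊨-sound φ s⊨φ sv)
  ⊨⁻-sound (φ ∧' ψ)   (_ , _ , lift s=s₁∪s₂ , s₁⊨¬φ , s₂⊨¬ψ) {v} sv with to (s=s₁∪s₂ v) sv
  ... | inj₁ s₁v = cong (_∧ ⟦ ψ ⟧ v) (⊨⁻-sound φ s₁⊨¬φ s₁v)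
  ... | inj₂ s₂v = trans (cong (⟦ φ ⟧ v ∧_) (⊨⁻-sound ψ s₂⊨¬ψ s₂v)) (∧-zeroʳ _)
  ⊨⁻-sound (φ ∨' ψ)   (s⊨¬φ , s⊨¬ψ) sv = cong₂ _∨_ (⊨⁻-sound φ s⊨¬φ sv) (⊨⁻-sound ψ s⊨¬ψ sv)
  ⊨⁻-sound (dep ps q) (lift s≡∅)    sv = ⊥-elim (s≡∅ _ sv)

mutual
  ｛｝⊨ : ∀ φ {v} → ⟦ φ ⟧ v ≡ true → ｛ v ｝ ⊨ φ
  ｛｝⊨ (atom p)   φv = lift λ { _ refl → φv }
  ｛｝⊨ bot        ()
  ｛｝⊨ (neg φ)    φv = ｛｝⊨⁻ φ (not-injective {y = false} φv)
  ｛｝⊨ (φ ∧' ψ)   φv = ｛｝⊨ φ (∧-conicalˡ _ _ φv) , ｛｝⊨ ψ (∧-conicalʳ _ _ φv)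
  ｛｝⊨ (φ ∨' ψ) {v} φ∨ψv with ⟦ φ ⟧ v in φv
  ... | true  = ｛ v ｝ , ∅ , lift ≐-∪-identityʳ , ｛｝⊨ φ φv , ⊨-empty ψ λ _ ()
  ... | false = ∅ , ｛ v ｝ , lift ≐-∪-identityˡ , ⊨-empty φ (λ _ ()) , ｛｝⊨ ψ φ∨ψv
  ｛｝⊨ (dep ps q) _  = lift λ { _ _ refl refl _ → refl }

  ｛｝⊨⁻ : ∀ φ {v} → ⟦ φ ⟧ v ≡ false → ｛ v ｝ ⊨⁻ φ
  ｛｝⊨⁻ (atom p)   φv = lift λ { _ refl → φv }
  ｛｝⊨⁻ bot        _  = tt
  ｛｝⊨⁻ (neg φ)    φv = ｛｝⊨ φ (not-injective {y = true} φv)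
  ｛｝⊨⁻ (φ ∧' ψ) {v} φ∧ψv with ⟦ φ ⟧ v in φv
  ... | false = ｛ v ｝ , ∅ , lift ≐-∪-identityʳ , ｛｝⊨⁻ φ φv , ⊨⁻-empty ψ λ _ ()
  ... | true  = ∅ , ｛ v ｝ , lift ≐-∪-identityˡ , ⊨⁻-empty φ (λ _ ()) , ｛｝⊨⁻ ψ φ∧ψv
  ｛｝⊨⁻ (φ ∨' ψ)   φv = ｛｝⊨⁻ φ (∨-conicalˡ _ _ φv) , ｛｝⊨⁻ ψ (∨-conicalʳ _ _ φv)
  ｛｝⊨⁻ (dep ps q) ()

mutual
  classical-⊨ : ∀ φ {s} → s ⊆ ⟦ φ ⟧⁻¹ true → s ⊨ classical φ
  classical-⊨ (atom p)   s⊆ = lift λ _ sv → s⊆ sv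
  classical-⊨ bot        s⊆ = lift λ _ sv → contradiction (s⊆ sv) λ ()
  classical-⊨ (neg φ)    s⊆ = classical-⊨⁻ φ λ sv → not-injective {y = false} (s⊆ sv)
  classical-⊨ (φ ∧' ψ)   s⊆ =
    classical-⊨ φ (λ sv → ∧-conicalˡ _ _ (s⊆ sv)) , classical-⊨ ψ (λ sv → ∧-conicalʳ _ _ (s⊆ sv))
  classical-⊨ (φ ∨' ψ) {s} s⊆ =
    s ∩ ⟦ φ ⟧⁻¹ true , s ∩ ⟦ φ ⟧⁻¹ false , lift (≐-∪-partition φ true) ,
    classical-⊨ φ proj₂ ,
    classical-⊨ ψ λ {v} (sv , φv≡false) → trans (sym (cong (_∨ ⟦ ψ ⟧ v) φv≡false)) (s⊆ sv)
  classical-⊨ (dep _ _)  s⊆ = tt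

  classical-⊨⁻ : ∀ φ {s} → s ⊆ ⟦ φ ⟧⁻¹ false → s ⊨⁻ classical φ
  classical-⊨⁻ (atom p)   s⊆ = lift λ _ sv → s⊆ sv
  classical-⊨⁻ bot        s⊆ = tt
  classical-⊨⁻ (neg φ)    s⊆ = classical-⊨ φ λ sv → not-injective {y = true} (s⊆ sv)
  classical-⊨⁻ (φ ∧' ψ) {s} s⊆ =
    s ∩ ⟦ φ ⟧⁻¹ false , s ∩ ⟦ φ ⟧⁻¹ true , lift (≐-∪-partition φ false) ,
    classical-⊨⁻ φ proj₂ ,
    classical-⊨⁻ ψ λ {v} (sv , φv≡true) → trans (sym (cong (_∧ ⟦ ψ ⟧ v) φv≡true)) (s⊆ sv)
  classical-⊨⁻ (φ ∨' ψ)   s⊆ =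
    classical-⊨⁻ φ (λ sv → ∨-conicalˡ _ _ (s⊆ sv)) , classical-⊨⁻ ψ (λ sv → ∨-conicalʳ _ _ (s⊆ sv))
  classical-⊨⁻ (dep _ _)  s⊆ = lift λ _ sv → contradiction (s⊆ sv) λ ()

classical-flat : ∀ φ {s} → s ⊨ classical φ ⇔ s ⊆ ⟦ φ ⟧⁻¹ true
classical-flat φ = mk⇔
  (λ s⊨cφ {v} sv → trans (sym (⟦classical⟧ φ v)) (⊨-sound (classical φ) s⊨cφ sv))
  (classical-⊨ φ)

classical-flat⁻ : ∀ φ {s} → s ⊨⁻ classical φ ⇔ s ⊆ ⟦ φ ⟧⁻¹ false
classical-flat⁻ φ = mk⇔
  (λ s⊨¬cφ {v} sv → trans (sym (⟦classical⟧ φ v)) (⊨⁻-sound (classical φ) s⊨¬cφ sv))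
  (classical-⊨⁻ φ)

｛｝-over : ∀ {X v} → ValOver X v → TeamOver X ｛ v ｝
｛｝-over v-over _ refl = v-over

∣∣-classical : ∀ φ X v → ∣ φ ∣ X v ⇔ (ValOver X v × ⟦ φ ⟧ v ≡ true)
∣∣-classical φ X v = mk⇔
  (λ (s , lift s-over , s⊨φ , lift sv) → s-over v sv , ⊨-sound φ s⊨φ sv)
  (λ (v-over , φv) → ｛ v ｝ , lift (｛｝-over v-over) , ｛｝⊨ φ φv , lift refl)

≡true⇔⇒≡ : ∀ {b c} → b ≡ true ⇔ c ≡ true → b ≡ c
≡true⇔⇒≡ {true}          b⇔c = sym (to b⇔c refl)
≡true⇔⇒≡ {false} {true}  b⇔c = from b⇔c refl
≡true⇔⇒≡ {false} {false} _   = refl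

≡F⇒⟦⟧≡ : ∀ φ θ {X v} → φ ≡F θ → X ⊇vars φ , θ → ValOver X v → ⟦ φ ⟧ v ≡ ⟦ θ ⟧ v
≡F⇒⟦⟧≡ φ θ {X} {v} φ≡θ X⊇ v-over = ≡true⇔⇒≡ (mk⇔
  (λ φv → ⊨-sound θ (to   ｛v｝⊨φ⇔θ (｛｝⊨ φ φv)) refl)
  (λ θv → ⊨-sound φ (from ｛v｝⊨φ⇔θ (｛｝⊨ θ θv)) refl))
  where
  ｛v｝⊨φ⇔θ : ｛ v ｝ ⊨ φ ⇔ ｛ v ｝ ⊨ θ
  ｛v｝⊨φ⇔θ = φ≡θ X X⊇ ｛ v ｝ (｛｝-over v-over)

ClassicallyComplementary : Form → Form → Set
ClassicallyComplementary φ ψ = ∀ X → X ⊇vars φ , ψ → ∀ v → ValOver X v → ⟦ φ ⟧ v ≢ ⟦ ψ ⟧ v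

complIn⇔ : ∀ X φ ψ → ComplIn X φ ψ ⇔ (∀ v → ValOver X v → ⟦ φ ⟧ v ≢ ⟦ ψ ⟧ v)
complIn⇔ X φ ψ = mk⇔ complIn⇒≢ ≢⇒complIn
  where
  ∣_∣⇔ : ∀ χ v → ∣ χ ∣ X v ⇔ (ValOver X v × ⟦ χ ⟧ v ≡ true)
  ∣ χ ∣⇔ = ∣∣-classical χ X

  complIn⇒≢ : ComplIn X φ ψ → ∀ v → ValOver X v → ⟦ φ ⟧ v ≢ ⟦ ψ ⟧ v
  complIn⇒≢ C v v-over φv≡ψv with ⟦ φ ⟧ v in φv
  ... | true  = v∉∣ψ∣ (from (∣ ψ ∣⇔ v) (v-over , sym φv≡ψv))
    where
    v∉∣ψ∣ : ¬ ∣ ψ ∣ X v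
    v∉∣ψ∣ = proj₂ (to (C v) (from (∣ φ ∣⇔ v) (v-over , φv)))
  ... | false = ⟦⟧⁻¹-disjoint φ true (proj₂ (to (∣ φ ∣⇔ v) v∈∣φ∣) , φv)
    where
    v∉∣ψ∣ : ¬ ∣ ψ ∣ X v
    v∉∣ψ∣ v∈∣ψ∣ = ⟦⟧⁻¹-disjoint ψ true (proj₂ (to (∣ ψ ∣⇔ v) v∈∣ψ∣) , sym φv≡ψv)
    v∈∣φ∣ : ∣ φ ∣ X v
    v∈∣φ∣ = from (C v) (from (∣ top ∣⇔ v) (v-over , refl) , v∉∣ψ∣)

  ≢⇒complIn : (∀ v → ValOver X v → ⟦ φ ⟧ v ≢ ⟦ ψ ⟧ v) → ComplIn X φ ψ
  ≢⇒complIn φ≢ψ v = mk⇔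
    (λ v∈∣φ∣ → let (v-over , φv) = to (∣ φ ∣⇔ v) v∈∣φ∣ in
      from (∣ top ∣⇔ v) (v-over , refl) ,
      λ v∈∣ψ∣ → φ≢ψ v v-over (trans φv (sym (proj₂ (to (∣ ψ ∣⇔ v) v∈∣ψ∣)))))
    (λ (v∈∣⊤∣ , v∉∣ψ∣) → let v-over = proj₁ (to (∣ top ∣⇔ v) v∈∣⊤∣) in
      from (∣ φ ∣⇔ v) (v-over ,
        trans (¬-not (φ≢ψ v v-over)) (cong not (¬-not (λ ψv → v∉∣ψ∣ (from (∣ ψ ∣⇔ v) (v-over , ψv)))))))

groundComplementary⇔ : ∀ φ ψ → GroundComplementary φ ψ ⇔ ClassicallyComplementary φ ψ
groundComplementary⇔ φ ψ = mk⇔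
  (λ gc X X⊇ → to (complIn⇔ X φ ψ) (proj₁ (gc X X⊇)))
  (λ cc X X⊇ → from (complIn⇔ X φ ψ) (cc X X⊇) ,
               from (complIn⇔ X ψ φ) (λ v v-over → ≢-sym (cc X X⊇ v v-over)))

NegationPair : Form → Form → Set₁
NegationPair φ ψ = Σ Form (λ θ → (φ ≡F θ) × (ψ ≡F neg θ) × SameVars θ φ ψ)

negationPair⇒classicallyComplementary : ∀ φ ψ → NegationPair φ ψ → ClassicallyComplementary φ ψ
negationPair⇒classicallyComplementary φ ψ (θ , φ≡θ , ψ≡¬θ , θ-vars) X X⊇ v v-over φv≡ψv =
  not-¬ φv≡θv (trans φv≡ψv ψv≡¬θv)
  where
  φv≡θv : ⟦ φ ⟧ v ≡ ⟦ θ ⟧ v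
  φv≡θv = ≡F⇒⟦⟧≡ φ θ φ≡θ (λ p → X⊇ p ∘ [ inj₁ , to (θ-vars p) ]′) v-over

  ψv≡¬θv : ⟦ ψ ⟧ v ≡ not (⟦ θ ⟧ v)
  ψv≡¬θv = ≡F⇒⟦⟧≡ ψ (neg θ) ψ≡¬θ (λ p → X⊇ p ∘ [ inj₂ , to (θ-vars p) ]′) v-over

module Construction (φ ψ : Form) where

  θ : Form
  θ = (φ ∨' neg (classical φ)) ∧' (neg ψ ∨' classical φ)

  θ-vars : SameVars θ φ ψ
  θ-vars p = mk⇔ split [ ∈-++⁺ˡ ∘ ∈-++⁺ˡ , ∈-++⁺ʳ (vars φ ++ vars (classical φ)) ∘ ∈-++⁺ˡ ]′
    where
    split : p ∈ vars θ → p ∈ vars φ ⊎ p ∈ vars ψ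
    split p∈θ with ∈-++⁻ (vars φ ++ vars (classical φ)) p∈θ
    ... | inj₁ p∈ˡ = [ inj₁ , inj₁ ∘ vars-classical φ ]′ (∈-++⁻ (vars φ) p∈ˡ)
    ... | inj₂ p∈ʳ = [ inj₂ , inj₁ ∘ vars-classical φ ]′ (∈-++⁻ (vars ψ) p∈ʳ)

  opposite : ClassicallyComplementary φ ψ → ∀ {X s v b} → X ⊇vars φ , ψ → TeamOver X s → s v →
             ⟦ ψ ⟧ v ≡ b → ⟦ φ ⟧ v ≡ not b
  opposite cc {X} {s} {v} X⊇ s-over sv ψv = trans (¬-not (cc X X⊇ v (s-over v sv))) (cong not ψv)

  φ≡θ : ClassicallyComplementary φ ψ → φ ≡F θ
  φ≡θ cc X X⊇ s s-over = mk⇔ intro elim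
    where
    X⊇φψ : X ⊇vars φ , ψ
    X⊇φψ p = X⊇ p ∘ [ inj₁ , inj₂ ∘ from (θ-vars p) ∘ inj₂ ]′

    intro : s ⊨ φ → s ⊨ θ
    intro s⊨φ =
      (s , ∅ , lift ≐-∪-identityʳ , s⊨φ , ⊨⁻-empty (classical φ) λ _ ()) ,
      (∅ , s , lift ≐-∪-identityˡ , ⊨⁻-empty ψ (λ _ ()) , from (classical-flat φ) (⊨-sound φ s⊨φ))

    elim : s ⊨ θ → s ⊨ φ
    elim ((t , u , lift s=t∪u , t⊨φ , u⊨¬cφ) , (t′ , u′ , lift s=t′∪u′ , t′⊨¬ψ , u′⊨cφ)) =
      ⊨-downClosed φ (≐-∪-⊆ˡ s=t∪u s⊥u) t⊨φ
      where
      φ-true : s ⊆ ⟦ φ ⟧⁻¹ true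
      φ-true {v} sv with to (s=t′∪u′ v) sv
      ... | inj₁ t′v = opposite cc X⊇φψ s-over sv (⊨⁻-sound ψ t′⊨¬ψ t′v)
      ... | inj₂ u′v = to (classical-flat φ) u′⊨cφ u′v

      s⊥u : s ⊥ u
      s⊥u (sv , uv) = ⟦⟧⁻¹-disjoint φ true (φ-true sv , to (classical-flat⁻ φ) u⊨¬cφ uv)

  ψ≡¬θ : ClassicallyComplementary φ ψ → ψ ≡F neg θ
  ψ≡¬θ cc X X⊇ s s-over = mk⇔ intro elim
    where
    X⊇φψ : X ⊇vars φ , ψ
    X⊇φψ p = X⊇ p ∘ [ inj₂ ∘ from (θ-vars p) ∘ inj₁ , inj₁ ]′

    intro : s ⊨ ψ → s ⊨ neg θ
    intro s⊨ψ =
      ∅ , s , lift ≐-∪-identityˡ ,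
      (⊨⁻-empty φ (λ _ ()) , ⊨-empty (classical φ) λ _ ()) ,
      (s⊨ψ , from (classical-flat⁻ φ) λ sv → opposite cc X⊇φψ s-over sv (⊨-sound ψ s⊨ψ sv))

    elim : s ⊨ neg θ → s ⊨ ψ
    elim (t , u , lift s=t∪u , (t⊨¬φ , t⊨cφ) , (u⊨ψ , _)) =
      ⊨-downClosed ψ (≐-∪-⊆ʳ s=t∪u s⊥t) u⊨ψ
      where
      s⊥t : s ⊥ t
      s⊥t (_ , tv) = ⟦⟧⁻¹-disjoint φ false (⊨⁻-sound φ t⊨¬φ tv , to (classical-flat φ) t⊨cφ tv)

  classicallyComplementary⇒negationPair : ClassicallyComplementary φ ψ → NegationPair φ ψ
  classicallyComplementary⇒negationPair cc = θ , φ≡θ cc , ψ≡¬θ cc , θ-vars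

open Construction using (classicallyComplementary⇒negationPair)

theorem3p33 : (φ ψ : Form) →
    GroundComplementary φ ψ ⇔
      Σ Form (λ θ → (φ ≡F θ) × (ψ ≡F neg θ) × SameVars θ φ ψ)
theorem3p33 φ ψ = mk⇔
  (classicallyComplementary⇒negationPair φ ψ ∘ to (groundComplementary⇔ φ ψ))
  (from (groundComplementary⇔ φ ψ) ∘ negationPair⇒classicallyComplementary φ ψ)
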